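{- If $n\geq 3$ and $m\geq 1$ are integers, then $$\chi_\rho(FSSD_m(S'(C_n))) = \begin{cases} 3, & n \text{ even},\\ 5, & n \text{ odd}.\end{cases}$$
   Context: All graphs are finite and simple. For a positive integer $i$, an $i$-packing is a set of vertices in which any two distinct vertices are at distance greater than $i$. The packing chromatic number $\chi_\rho(H)$ of a graph $H$ is the smallest integer $k$ such that $V(H)$ can be partitioned into sets $V_1,\dots,V_k$ with each $V_i$ an $i$-packing. The splitting graph $S'(G)$ of a graph $G$ with vertices $w_1,\dots,w_{n}$ is obtained from $G$ by adding $n$ new vertices $w_1',\dots,w_n'$ and joining each $w_i'$ to every neighbor of $w_i$ in $G$ (this is the neighborhood corona $G\star K_1$). $C_n$ is the cycle on $n$ vertices. For a positive integer $m$, the finite super subdivision graph $FSSD_m(G)$ is obtained from a graph $G$ by replacing each edge $xy$ of $G$ by a complete bipartite graph $K_{2,m}$ whose part of size $2$ is $\{x,y\}$; that is, the edge $xy$ is deleted and $m$ new vertices are added, each adjacent exactly to $x$ and $y$. -}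

module Defs where

open import Data.Nat using (ℕ; zero; suc; _+_; _≤_; _<_)
open import Data.Nat as ℕ using (_≡ᵇ_)
open import Data.Bool using (Bool; true; false; T; _∨_; _∧_)
open import Data.Fin using (Fin; toℕ)
open import Data.Sum using (_⊎_; inj₁; inj₂)
open import Data.Product using (Σ; _×_; _,_; ∃-syntax)
open import Data.Empty using (⊥)
open import Relation.Binary.PropositionalEquality using (_≡_; _≢_)
open import Relation.Nullary using (¬_)

record Graph : Set₁ where
  field
    Vertex : Set
    Adj    : Vertex → Vertex → Set
open Graph public

data Walk (G : Graph) : Vertex G → Vertex G → ℕ → Set where
  here : ∀ {u} → Walk G u u 0
  step : ∀ {u v w k} → Adj G u v → Walk G v w k → Walk G u w (suc k)

-- dist(u,v) > i  iff there is no walk of length ≤ i from u to v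
DistGreater : (G : Graph) → Vertex G → Vertex G → ℕ → Set
DistGreater G u v i = ∀ k → k ≤ i → ¬ Walk G u v k

-- A packing coloring with colours 1..k (colour class V_{j+1} is c ⁻¹ j, j : Fin k);
-- each class V_i must be an i-packing.
PackingColoring : (G : Graph) → ℕ → Set
PackingColoring G k =
  Σ (Vertex G → Fin k) λ c →
    ∀ u v → u ≢ v → c u ≡ c v → DistGreater G u v (suc (toℕ (c u)))

PackingChromaticNumber : Graph → ℕ → Set
PackingChromaticNumber G k =
  PackingColoring G k × (∀ j → j < k → ¬ PackingColoring G j)

-- The cycle C_n on vertices 0..n-1 (intended for n ≥ 3).
cycleAdj : (n : ℕ) → Fin n → Fin n → Bool
cycleAdj n i j =
  (toℕ j ≡ᵇ suc (toℕ i)) ∨ (toℕ i ≡ᵇ suc (toℕ j))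
  ∨ ((toℕ i ≡ᵇ 0) ∧ (suc (toℕ j) ≡ᵇ n))
  ∨ ((toℕ j ≡ᵇ 0) ∧ (suc (toℕ i) ≡ᵇ n))

C : ℕ → Graph
C n = record { Vertex = Fin n ; Adj = λ i j → T (cycleAdj n i j) }

-- Splitting graph S'(G): inj₁ w are the original vertices, inj₂ w is the copy w'.
splitAdj : (G : Graph) → Vertex G ⊎ Vertex G → Vertex G ⊎ Vertex G → Set
splitAdj G (inj₁ a) (inj₁ b) = Adj G a b
splitAdj G (inj₁ a) (inj₂ b) = Adj G a b
splitAdj G (inj₂ a) (inj₁ b) = Adj G a b
splitAdj G (inj₂ a) (inj₂ b) = ⊥

S' : Graph → Graph
S' G = record { Vertex = Vertex G ⊎ Vertex G ; Adj = splitAdj G }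

-- To index each (unordered) edge xy once,
-- an injective key : Vertex G → ℕ is used to orient it: the edge is recorded
-- as (x , y) with key x < key y.
Edge : (G : Graph) → (Vertex G → ℕ) → Set
Edge G key = Σ (Vertex G) λ x → Σ (Vertex G) λ y → Adj G x y × key x < key y

FSSDVertex : ℕ → (G : Graph) → (Vertex G → ℕ) → Set
FSSDVertex m G key = Vertex G ⊎ (Edge G key × Fin m)

fssdAdj : (m : ℕ) (G : Graph) (key : Vertex G → ℕ) →
          FSSDVertex m G key → FSSDVertex m G key → Set
fssdAdj m G key (inj₁ a) (inj₁ b) = ⊥
fssdAdj m G key (inj₁ a) (inj₂ ((x , y , _) , _)) = a ≡ x ⊎ a ≡ y
fssdAdj m G key (inj₂ ((x , y , _) , _)) (inj₁ b) = b ≡ x ⊎ b ≡ y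
fssdAdj m G key (inj₂ _) (inj₂ _) = ⊥

FSSD : ℕ → (G : Graph) → (Vertex G → ℕ) → Graph
FSSD m G key = record { Vertex = FSSDVertex m G key ; Adj = fssdAdj m G key }

keyS'C : (n : ℕ) → Vertex (S' (C n)) → ℕ
keyS'C n (inj₁ i) = toℕ i
keyS'C n (inj₂ i) = n + toℕ i

Even : ℕ → Set
Even n = ∃[ k ] n ≡ k + k

module Submission where

-- In G = FSSD_m(H) the subdivision vertices are pairwise non-adjacent and vertices of
-- H at distance d in H are at distance 2d in G.  Hence (module Subdivision):
--  * lift-colouring: colour 1 on the subdivision vertices plus a proper colouring of H
--    by colours ≥ 2, each colour ≥ 4 used at most once, is a packing colouring of G.
--    Colouring w_i, w_i′ by the parity of i uses 3 colours when n is even; for odd n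
--    the vertices w_{n-1}, w′_{n-1} get 4 and 5 instead (module Instance).
--  * no-packing-2-colouring: a path in H gives a path on four vertices in G.
--  * For odd n, a packing 4-colouring is impossible: no w_i gets colour 1 (its four
--    neighbours in S'(C_n) yield four neighbours in G at mutual distance 2 — pigeonhole),
--    consecutive w_i differ, and both neighbours of a w_i coloured 4 agree (no-2-4-3,
--    module SplitSubdivision).  Reading each 4 as the colour opposite to its neighbours
--    then properly 2-colours the odd cycle (periodic-colouring-even), a contradiction.

open import Defs
open import Data.Nat using (_≡ᵇ_; parity; ℕ; zero; suc; _+_; _≤_; _<_; z≤n; s≤s; _≟_; _≤?_)
open import Data.Nat.DivMod using (_mod_; _%_; m%n<n; n%n≡0; m<n⇒m%n≡m; %-distribˡ-+; [m+n]%n≡m%n)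
open import Data.Nat.Properties
  using (≤-refl; ≤-trans; ≰⇒>; ≤⇒≯; n≤1+n; n<1+n; m≤m+n; ≤∧≢⇒<; <-cmp; +-suc; +-cancelˡ-≡;
         suc-injective; 1+n≢n; m≢1+n+m; ≡ᵇ⇒≡; ≡⇒≡ᵇ)
open import Data.Fin using (Fin; toℕ; punchOut; inject≤) renaming (zero to fzero; suc to fsuc)
open import Data.Fin.Properties
  using (toℕ-injective; toℕ<n; toℕ-fromℕ<; toℕ-inject≤; inject≤-injective;
         pigeonhole; punchOut-injective)
open import Data.Sum using (_⊎_; inj₁; inj₂; [_,_]′; swap)
open import Data.Sum.Properties using (inj₁-injective; inj₂-injective)
open import Data.Product using (∃₂; _×_; _,_; proj₁; proj₂)
open import Data.Empty using (⊥; ⊥-elim)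
open import Relation.Binary.PropositionalEquality
  using (_≡_; _≢_; refl; sym; trans; cong; cong₂; subst; module ≡-Reasoning)
open import Relation.Binary.Definitions using (tri<; tri≈; tri>)
open import Relation.Nullary using (¬_; yes; no)
open import Data.Bool using (Bool; true; false; not; T; _∧_)
open import Data.Bool.Properties using (T-∨; T-∧; not-involutive; ¬-not; not-¬)
open import Function.Bundles using (Equivalence)
open Equivalence using (to; from)
open import Data.Parity.Base using (Parity; 0ℙ; 1ℙ; _⁻¹)
open import Data.Parity.Properties using (suc-homo-⁻¹; ⁻¹-selfInverse; +-homo-+; p+p≡0ℙ; p≢p⁻¹)

-- Colours 1, 2, 3, 4; a colouring with k colours takes values in Fin k (0-based).
pattern col₁ = fzero
pattern col₂ = fsuc fzero
pattern col₃ = fsuc (fsuc fzero)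
pattern col₄ = fsuc (fsuc (fsuc fzero))

-- A step through a named vertex (adjacency alone need not determine it).
via : ∀ {G u w k} (v : Vertex G) → Adj G u v → Walk G v w k → Walk G u w (suc k)
via v uv p = step uv p

_++ʷ_ : ∀ {G u v w k l} → Walk G u v k → Walk G v w l → Walk G u w (k + l)
here ++ʷ q = q
step a p ++ʷ q = step a (p ++ʷ q)

-- The packing condition in usable form: distinct vertices sharing colour i are joined
-- by no walk of length at most i + 1 (colour i is stored as i - 1).
module Packing {G : Graph} {k : ℕ} (pc : PackingColoring G k) where

  colour : Vertex G → Fin k
  colour = proj₁ pc

  clash : ∀ {u v ℓ} (i : Fin k) → u ≢ v → colour u ≡ i → colour v ≡ i →
          Walk G u v ℓ → ℓ ≤ suc (toℕ i) → ⊥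
  clash {u} {v} {ℓ} i u≢v cu cv walk ℓ≤ =
    proj₂ pc u v u≢v (trans cu (sym cv)) ℓ (subst (λ j → ℓ ≤ suc (toℕ j)) (sym cu) ℓ≤) walk

2≤colour : ∀ {k} (i : Fin (suc k)) → i ≢ col₁ → 2 ≤ suc (toℕ i)
2≤colour col₁ i≢1 = ⊥-elim (i≢1 refl)
2≤colour (fsuc i) _ = s≤s (s≤s z≤n)

packing-mono : ∀ {G j k} → j ≤ k → PackingColoring G j → PackingColoring G k
packing-mono {G} j≤k (c , packed) =
  (λ u → inject≤ (c u) j≤k) ,
  λ u v u≢v same → subst (DistGreater G u v) (cong suc (sym (toℕ-inject≤ (c u) j≤k)))
                     (packed u v u≢v (inject≤-injective j≤k j≤k (c u) (c v) same))

no-packing-below : ∀ {G j} → ¬ PackingColoring G j → ∀ i → i < suc j → ¬ PackingColoring G i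
no-packing-below none i (s≤s i≤j) pc = none (packing-mono i≤j pc)

-- A vertex with k + 1 pairwise distinct neighbours never receives colour 1 in a packing
-- (k+1)-colouring: its neighbours, pairwise at distance 2, would need k + 1 distinct
-- colours from {2, …, k+1}.
crowded-vertex-not-1 : ∀ {G k} (pc : PackingColoring G (suc k)) (u : Vertex G)
  (v : Fin (suc k) → Vertex G) → (∀ {i j} → i Data.Fin.< j → v i ≢ v j) →
  (∀ i → u ≢ v i) → (∀ i → Adj G u (v i)) → (∀ i → Adj G (v i) u) →
  Packing.colour pc u ≢ col₁
crowded-vertex-not-1 {k = k} pc u v distinct u≢v u→v v→u u↦1 =
  repeated-colour (pigeonhole (n<1+n k) (λ i → punchOut (neighbour-not-1 i)))
  where
  open Packing pc
  neighbour-not-1 : ∀ i → col₁ ≢ colour (v i)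
  neighbour-not-1 i vi↦1 = clash col₁ (u≢v i) u↦1 (sym vi↦1) (step (u→v i) here) ≤-refl
  -- two neighbours with the same colour (≠ 1) are at distance 2
  repeated-colour : (∃₂ λ i j → i Data.Fin.< j ×
                      punchOut (neighbour-not-1 i) ≡ punchOut (neighbour-not-1 j)) → ⊥
  repeated-colour (i , j , i<j , same) =
    clash (colour (v i)) (distinct i<j) refl
      (sym (punchOut-injective (neighbour-not-1 i) (neighbour-not-1 j) same))
      (step (v→u i) (step (u→v j) here)) (2≤colour _ (λ e → neighbour-not-1 i (sym e)))

-- The path on four vertices has packing chromatic number 3: with colours 1 and 2,
-- the vertices at distance 2 must share colour 1, forcing two adjacent 1's.
path-not-2-colourable : ∀ {G} (pc : PackingColoring G 2) {x₀ x₁ x₂ x₃ : Vertex G} →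
  Adj G x₀ x₁ → Adj G x₁ x₂ → Adj G x₂ x₃ →
  x₀ ≢ x₁ → x₁ ≢ x₂ → x₂ ≢ x₃ → x₀ ≢ x₂ → x₁ ≢ x₃ → ⊥
path-not-2-colourable {G} pc {x₀} {x₁} {x₂} {x₃} a₀₁ a₁₂ a₂₃ d₀₁ d₁₂ d₂₃ d₀₂ d₁₃ =
  four-colours (colour x₀) (colour x₁) (colour x₂) (colour x₃)
    (adjacent-differ d₀₁ a₀₁) (adjacent-differ d₁₂ a₁₂) (adjacent-differ d₂₃ a₂₃)
    (apart d₀₂ (step a₀₁ (step a₁₂ here))) (apart d₁₃ (step a₁₂ (step a₂₃ here)))
  where
  open Packing pc
  adjacent-differ : ∀ {x y} → x ≢ y → Adj G x y → colour x ≢ colour y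
  adjacent-differ {x} x≢y xy same = clash (colour x) x≢y refl (sym same) (step xy here) (s≤s z≤n)
  apart : ∀ {x y} → x ≢ y → Walk G x y 2 → colour x ≡ colour y → colour x ≡ col₁
  apart {x} x≢y walk same with colour x in cx
  ... | col₁ = refl
  ... | col₂ = ⊥-elim (clash col₂ x≢y cx (sym same) walk ≤-refl)
  four-colours : (a b d e : Fin 2) → a ≢ b → b ≢ d → d ≢ e →
                 (a ≡ d → a ≡ col₁) → (b ≡ e → b ≡ col₁) → ⊥
  four-colours fzero fzero _ _ a≢b _ _ _ _ = a≢b refl
  four-colours (fsuc fzero) (fsuc fzero) _ _ a≢b _ _ _ _ = a≢b refl
  four-colours fzero (fsuc fzero) (fsuc fzero) _ _ b≢d _ _ _ = b≢d refl
  four-colours (fsuc fzero) fzero fzero _ _ b≢d _ _ _ = b≢d refl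
  four-colours fzero (fsuc fzero) fzero fzero _ _ d≢e _ _ = d≢e refl
  four-colours fzero (fsuc fzero) fzero (fsuc fzero) _ _ _ _ b≡e⇒1 with b≡e⇒1 refl
  ... | ()
  four-colours (fsuc fzero) fzero (fsuc fzero) _ _ _ _ a≡d⇒1 _ with a≡d⇒1 refl
  ... | ()

module Subdivision (H : Graph) (key : Vertex H → ℕ)
  (key-injective : ∀ u v → key u ≡ key v → u ≡ v)
  (irreflexive : ∀ u → ¬ Adj H u u)
  (symmetric : ∀ u v → Adj H u v → Adj H v u)
  (m : ℕ) where

  G : Graph
  G = FSSD (suc m) H key

  adjacent-distinct : ∀ {u v} → Adj H u v → u ≢ v
  adjacent-distinct {u} uv refl = irreflexive u uv

  keys-differ : ∀ {u v} → Adj H u v → key u ≢ key v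
  keys-differ {u} {v} uv same = adjacent-distinct uv (key-injective u v same)

  edge : (u v : Vertex H) → Adj H u v → Edge H key
  edge u v uv with <-cmp (key u) (key v)
  ... | tri< u<v _ _ = u , v , uv , u<v
  ... | tri≈ _ same _ = ⊥-elim (keys-differ uv same)
  ... | tri> _ _ v<u = v , u , symmetric u v uv , v<u

  Incident : Edge H key → Vertex H → Set
  Incident (x , y , _) w = w ≡ x ⊎ w ≡ y

  edge-ends : ∀ u v uv w → Incident (edge u v uv) w → w ≡ u ⊎ w ≡ v
  edge-ends u v uv w with <-cmp (key u) (key v)
  ... | tri< _ _ _ = λ w∈ → w∈
  ... | tri≈ _ same _ = ⊥-elim (keys-differ uv same)
  ... | tri> _ _ _ = swap

  edge-has-ends : ∀ u v uv w → w ≡ u ⊎ w ≡ v → Incident (edge u v uv) w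
  edge-has-ends u v uv w with <-cmp (key u) (key v)
  ... | tri< _ _ _ = λ w∈ → w∈
  ... | tri≈ _ same _ = ⊥-elim (keys-differ uv same)
  ... | tri> _ _ _ = swap

  mid : (u v : Vertex H) → Adj H u v → Vertex G
  mid u v uv = inj₂ (edge u v uv , fzero)

  left→mid : ∀ {u v} (uv : Adj H u v) → Adj G (inj₁ u) (mid u v uv)
  left→mid {u} {v} uv = edge-has-ends u v uv u (inj₁ refl)

  right→mid : ∀ {u v} (uv : Adj H u v) → Adj G (inj₁ v) (mid u v uv)
  right→mid {u} {v} uv = edge-has-ends u v uv v (inj₂ refl)

  mid→left : ∀ {u v} (uv : Adj H u v) → Adj G (mid u v uv) (inj₁ u)
  mid→left = left→mid

  mid→right : ∀ {u v} (uv : Adj H u v) → Adj G (mid u v uv) (inj₁ v)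
  mid→right = right→mid

  mid-shared-end : ∀ {u v u′ v′} (uv : Adj H u v) (uv′ : Adj H u′ v′) →
                   mid u v uv ≡ mid u′ v′ uv′ → u′ ≡ u ⊎ u′ ≡ v
  mid-shared-end {u} {v} {u′} uv uv′ same =
    edge-ends u v uv u′ (subst (Adj G (inj₁ u′)) (sym same) (left→mid uv′))

  hop : ∀ {u v} → Adj H u v → Walk G (inj₁ u) (inj₁ v) 2
  hop {u} {v} uv = via (mid u v uv) (left→mid uv) (step (mid→right uv) here)

  -- G is bipartite with the vertices of H on one side, and two vertices of H at
  -- distance 2 in G are adjacent in H: so walks of length ≤ 3 between vertices of H
  -- only join equal or H-adjacent vertices.
  short-walk : ∀ {u v ℓ} → ℓ ≤ 3 → Walk G (inj₁ u) (inj₁ v) ℓ → u ≡ v ⊎ Adj H u v ⊎ Adj H v u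
  short-walk _ here = inj₁ refl
  short-walk _ (step {v = inj₁ _} () _)
  short-walk _ (step {v = inj₂ _} _ (step {v = inj₂ _} () _))
  short-walk _ (step {v = inj₂ ((x , y , xy , _) , _)} u∈ (step {v = inj₁ _} v∈ here)) =
    common-edge u∈ v∈
    where
    common-edge : ∀ {u v} → u ≡ x ⊎ u ≡ y → v ≡ x ⊎ v ≡ y → u ≡ v ⊎ Adj H u v ⊎ Adj H v u
    common-edge (inj₁ refl) (inj₁ refl) = inj₁ refl
    common-edge (inj₂ refl) (inj₂ refl) = inj₁ refl
    common-edge (inj₁ refl) (inj₂ refl) = inj₂ (inj₁ xy)
    common-edge (inj₂ refl) (inj₁ refl) = inj₂ (inj₂ xy)
  short-walk _ (step {v = inj₂ _} _ (step {v = inj₁ _} _ (step {v = inj₁ _} () _)))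
  short-walk (s≤s (s≤s (s≤s ()))) (step _ (step _ (step _ (step _ _))))

  -- Same-coloured vertices of H then lie at distance ≥ 4 in G, and the
  -- subdivision vertices are pairwise non-adjacent.
  lift-colouring : ∀ {j} (f : Vertex H → Fin (suc j)) → (∀ u → f u ≢ col₁) →
    (∀ u v → Adj H u v → f u ≢ f v) → (∀ u v → 3 ≤ toℕ (f u) → f u ≡ f v → u ≡ v) →
    PackingColoring G (suc j)
  lift-colouring {j} f not-1 proper unique = colouring , packed
    where
    colouring : Vertex G → Fin (suc j)
    colouring (inj₁ u) = f u
    colouring (inj₂ _) = col₁
    packed : ∀ x y → x ≢ y → colouring x ≡ colouring y →
             DistGreater G x y (suc (toℕ (colouring x)))
    packed (inj₁ u) (inj₂ _) _ same = ⊥-elim (not-1 u same)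
    packed (inj₂ _) (inj₁ v) _ same = ⊥-elim (not-1 v (sym same))
    packed (inj₂ s) (inj₂ .s) s≢s _ _ _ here = s≢s refl
    packed (inj₂ _) (inj₂ _) _ _ (suc zero) _ (step {v = inj₁ _} _ ())
    packed (inj₂ _) (inj₂ _) _ _ _ _ (step {v = inj₂ _} () _)
    packed (inj₂ _) (inj₂ _) _ _ (suc (suc _)) (s≤s ()) _
    packed (inj₁ u) (inj₁ v) u≢v same ℓ ℓ≤ walk with toℕ (f u) ≤? 2
    ... | yes small = [ (λ u≡v → u≢v (cong inj₁ u≡v)) ,
                        [ (λ uv → proper u v uv same) , (λ vu → proper v u vu (sym same)) ]′ ]′
                      (short-walk (≤-trans ℓ≤ (s≤s small)) walk)
    ... | no big = u≢v (cong inj₁ (unique u v (≰⇒> big) same))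

  -- Lower bound 3: a path u v w in H gives a path on four vertices in G.
  no-packing-2-colouring : ∀ {u v w} → Adj H u v → Adj H v w → u ≢ w → ¬ PackingColoring G 2
  no-packing-2-colouring {u} {v} {w} uv vw u≢w pc =
    path-not-2-colourable pc {inj₁ u} {mid u v uv} {inj₁ v} {mid v w vw}
      (left→mid uv) (mid→right uv) (left→mid vw) (λ ()) (λ ()) (λ ())
      (λ u≡v → adjacent-distinct uv (inj₁-injective u≡v)) different-mids
    where
    different-mids : mid u v uv ≢ mid v w vw
    different-mids same with mid-shared-end vw uv (sym same)
    ... | inj₁ u≡v = adjacent-distinct uv u≡v
    ... | inj₂ u≡w = u≢w u≡w

  -- In a packing (k+1)-colouring of G, a vertex of H with k + 1 distinct neighbours
  -- in H does not get colour 1: the first subdivision vertices of those edges are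
  -- k + 1 distinct neighbours in G.
  crowded-original-not-1 : ∀ {k} (pc : PackingColoring G (suc k)) (b : Vertex H)
    (o : Fin (suc k) → Vertex H) → (∀ {i j} → i Data.Fin.< j → o i ≢ o j) →
    (o→b : ∀ i → Adj H (o i) b) → Packing.colour pc (inj₁ b) ≢ col₁
  crowded-original-not-1 pc b o distinct o→b =
    crowded-vertex-not-1 pc (inj₁ b) (λ i → mid (o i) b (o→b i)) mids-distinct
      (λ _ ()) (λ i → right→mid (o→b i)) (λ i → mid→right (o→b i))
    where
    mids-distinct : ∀ {i j} → i Data.Fin.< j → mid (o i) b (o→b i) ≢ mid (o j) b (o→b j)
    mids-distinct {i} {j} i<j same with mid-shared-end (o→b i) (o→b j) same
    ... | inj₁ oj≡oi = distinct i<j (sym oj≡oi)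
    ... | inj₂ oj≡b = adjacent-distinct (o→b j) oj≡b

  -- H-adjacent vertices are at distance 2 in G, so they get different colours
  -- unless they have colour 1.
  adjacent-originals-differ : ∀ {k} (pc : PackingColoring G (suc k)) {u v} → Adj H u v →
    Packing.colour pc (inj₁ u) ≢ col₁ →
    Packing.colour pc (inj₁ u) ≢ Packing.colour pc (inj₁ v)
  adjacent-originals-differ pc {u} uv not-1 same =
    clash (colour (inj₁ u)) (λ u≡v → adjacent-distinct uv (inj₁-injective u≡v)) refl (sym same)
      (hop uv) (2≤colour _ not-1)
    where open Packing pc

S'-irreflexive : ∀ {H₀} → (∀ a → ¬ Adj H₀ a a) → ∀ u → ¬ Adj (S' H₀) u u
S'-irreflexive irr₀ (inj₁ a) = irr₀ a
S'-irreflexive irr₀ (inj₂ a) ()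

S'-symmetric : ∀ {H₀} → (∀ a b → Adj H₀ a b → Adj H₀ b a) →
               ∀ u v → Adj (S' H₀) u v → Adj (S' H₀) v u
S'-symmetric sym₀ (inj₁ a) (inj₁ b) ab = sym₀ a b ab
S'-symmetric sym₀ (inj₁ a) (inj₂ b) ab = sym₀ a b ab
S'-symmetric sym₀ (inj₂ a) (inj₁ b) ab = sym₀ a b ab

split-proper : ∀ {H₀} {X : Set} (f f′ : Vertex H₀ → X) →
  (∀ a b → Adj H₀ a b → f a ≢ f b × f a ≢ f′ b × f′ a ≢ f b) →
  ∀ u v → Adj (S' H₀) u v → [ f , f′ ]′ u ≢ [ f , f′ ]′ v
split-proper f f′ edge-ok (inj₁ a) (inj₁ b) ab = proj₁ (edge-ok a b ab)
split-proper f f′ edge-ok (inj₁ a) (inj₂ b) ab = proj₁ (proj₂ (edge-ok a b ab))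
split-proper f f′ edge-ok (inj₂ a) (inj₁ b) ab = proj₂ (proj₂ (edge-ok a b ab))

module SplitSubdivision (H₀ : Graph)
  (irreflexive₀ : ∀ a → ¬ Adj H₀ a a) (symmetric₀ : ∀ a b → Adj H₀ a b → Adj H₀ b a)
  (key : Vertex (S' H₀) → ℕ) (key-injective : ∀ u v → key u ≡ key v → u ≡ v) (m : ℕ) where

  open Subdivision (S' H₀) key key-injective
    (S'-irreflexive irreflexive₀) (S'-symmetric symmetric₀) m public

  w w′ : Vertex H₀ → Vertex G
  w a = inj₁ (inj₁ a)
  w′ a = inj₁ (inj₂ a)

  -- A vertex b of H₀ with two distinct neighbours a, d has the four distinct
  -- neighbours a, a′, d, d′ in S'(H₀), so w b does not get colour 1.
  split-vertex-not-1 : (pc : PackingColoring G 4) → ∀ {a b d} →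
    Adj H₀ a b → Adj H₀ d b → a ≢ d → Packing.colour pc (w b) ≢ col₁
  split-vertex-not-1 pc {a} {b} {d} ab db a≢d =
    crowded-original-not-1 pc (inj₁ b) neighbour distinct adjacent
    where
    neighbour : Fin 4 → Vertex (S' H₀)
    neighbour fzero = inj₁ a
    neighbour (fsuc fzero) = inj₂ a
    neighbour (fsuc (fsuc fzero)) = inj₁ d
    neighbour (fsuc (fsuc (fsuc fzero))) = inj₂ d
    adjacent : ∀ i → Adj (S' H₀) (neighbour i) (inj₁ b)
    adjacent fzero = ab
    adjacent (fsuc fzero) = ab
    adjacent (fsuc (fsuc fzero)) = db
    adjacent (fsuc (fsuc (fsuc fzero))) = db
    distinct : ∀ {i j} → i Data.Fin.< j → neighbour i ≢ neighbour j
    distinct {fzero} {fsuc fzero} _ = λ ()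
    distinct {fzero} {fsuc (fsuc fzero)} _ = λ a≡d → a≢d (inj₁-injective a≡d)
    distinct {fzero} {fsuc (fsuc (fsuc fzero))} _ = λ ()
    distinct {fsuc fzero} {fsuc (fsuc fzero)} _ = λ ()
    distinct {fsuc fzero} {fsuc (fsuc (fsuc fzero))} _ = λ a≡d → a≢d (inj₂-injective a≡d)
    distinct {fsuc (fsuc fzero)} {fsuc (fsuc (fsuc fzero))} _ = λ ()
    distinct {fzero} {fzero} ()
    distinct {fsuc _} {fzero} ()
    distinct {fsuc fzero} {fsuc fzero} (s≤s ())
    distinct {fsuc (fsuc _)} {fsuc fzero} (s≤s ())
    distinct {fsuc (fsuc fzero)} {fsuc (fsuc fzero)} (s≤s (s≤s ()))
    distinct {fsuc (fsuc (fsuc fzero))} {fsuc (fsuc fzero)} (s≤s (s≤s ()))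
    distinct {fsuc (fsuc (fsuc fzero))} {fsuc (fsuc (fsuc fzero))} (s≤s (s≤s (s≤s ())))

  -- Consecutive vertices a, b, d of H₀ cannot be coloured 2, 4, 3.  The copy b′ is at
  -- distance 2 from a and d and at distance 4 from b, so it has colour 1; then the
  -- subdivision vertex y between a and b′ is within distance 1, 1, 3, 3 of vertices
  -- coloured 1, 2, 3, 4 (namely b′, a, d, b).
  no-2-4-3 : (pc : PackingColoring G 4) → ∀ {a b d} → Adj H₀ a b → Adj H₀ b d →
    Packing.colour pc (w a) ≡ col₂ → Packing.colour pc (w b) ≡ col₄ →
    Packing.colour pc (w d) ≡ col₃ → ⊥
  no-2-4-3 pc {a} {b} {d} ab bd a↦2 b↦4 d↦3 = y-uncolourable (colour y) refl
    where
    open Packing pc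
    b′↦1 : colour (w′ b) ≡ col₁
    b′↦1 with colour (w′ b) in b′↦
    ... | col₁ = refl
    ... | col₂ = ⊥-elim (clash col₂ (λ ()) b′↦ a↦2 (hop (symmetric₀ a b ab)) ≤-refl)
    ... | col₃ = ⊥-elim (clash col₃ (λ ()) b′↦ d↦3 (hop bd) (n≤1+n 2))
    ... | col₄ = ⊥-elim (clash col₄ (λ ()) b′↦ b↦4
                            (hop {inj₂ b} {inj₁ d} bd ++ʷ hop (symmetric₀ b d bd)) ≤-refl)
    y : Vertex G
    y = mid (inj₁ a) (inj₂ b) ab
    y-uncolourable : ∀ i → colour y ≡ i → ⊥
    y-uncolourable col₁ y↦ = clash col₁ (λ ()) y↦ b′↦1 (step (mid→right ab) here) ≤-refl
    y-uncolourable col₂ y↦ = clash col₂ (λ ()) y↦ a↦2 (step (mid→left ab) here) (n≤1+n 1)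
    y-uncolourable col₃ y↦ = clash col₃ (λ ()) y↦ d↦3 (via (w′ b) (mid→right ab) (hop bd)) ≤-refl
    y-uncolourable col₄ y↦ =
      clash col₄ (λ ()) y↦ b↦4 (via (w a) (mid→left ab) (hop {inj₁ a} {inj₁ b} ab)) (n≤1+n 3)

parity-suc : ∀ n → parity (suc n) ≡ parity n ⁻¹
parity-suc n = sym (⁻¹-selfInverse (suc-homo-⁻¹ n))

Even⇒parity≡0ℙ : ∀ {n} → Even n → parity n ≡ 0ℙ
Even⇒parity≡0ℙ (k , refl) = trans (+-homo-+ k k) (p+p≡0ℙ (parity k))

parity≡0ℙ⇒Even : ∀ n → parity n ≡ 0ℙ → Even n
parity≡0ℙ⇒Even zero _ = 0 , refl
parity≡0ℙ⇒Even (suc zero) ()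
parity≡0ℙ⇒Even (suc (suc n)) even with parity≡0ℙ⇒Even n even
... | k , refl = suc k , cong suc (sym (+-suc k k))

toggle : Parity → Bool → Bool
toggle 0ℙ b = b
toggle 1ℙ b = not b

toggle-⁻¹ : ∀ p b → toggle (p ⁻¹) b ≡ not (toggle p b)
toggle-⁻¹ 0ℙ b = refl
toggle-⁻¹ 1ℙ b = sym (not-involutive b)

toggle-fixed : ∀ p b → toggle p b ≡ b → p ≡ 0ℙ
toggle-fixed 0ℙ b _ = refl
toggle-fixed 1ℙ b flipped = ⊥-elim (not-¬ refl (sym flipped))

-- A Boolean sequence that changes at every step can only return to its initial
-- value after an even number of steps (an odd cycle is not 2-colourable).
alternating-return-even : (g : ℕ → Bool) → (∀ x → g x ≢ g (suc x)) →
                          ∀ n → g n ≡ g 0 → Even n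
alternating-return-even g changes n returns =
  parity≡0ℙ⇒Even n (toggle-fixed (parity n) (g 0) (trans (sym (by-parity n)) returns))
  where
  by-parity : ∀ x → g x ≡ toggle (parity x) (g 0)
  by-parity zero = refl
  by-parity (suc x) = begin
    g (suc x)                       ≡⟨ ¬-not (λ e → changes x (sym e)) ⟩
    not (g x)                       ≡⟨ cong not (by-parity x) ⟩
    not (toggle (parity x) (g 0))   ≡⟨ sym (toggle-⁻¹ (parity x) (g 0)) ⟩
    toggle (parity x ⁻¹) (g 0)      ≡⟨ cong (λ p → toggle p (g 0)) (sym (parity-suc x)) ⟩
    toggle (parity (suc x)) (g 0)   ∎
    where open ≡-Reasoning

-- Colours 2, 3, 4 around a cycle, read as colours 2 and 3: a vertex coloured 4 takes
-- the colour opposite to its successor (true stands for colour 3).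
effective : Fin 4 → Fin 4 → Bool
effective col₃ _ = true
effective col₄ col₂ = true
effective _ _ = false

effective-alternates : ∀ {a b d} → a ≢ col₁ → b ≢ col₁ → a ≢ b → (b ≡ col₄ → a ≡ d) →
                       effective a b ≢ effective b d
effective-alternates {col₁} a≢1 _ _ _ = ⊥-elim (a≢1 refl)
effective-alternates {_} {col₁} _ b≢1 _ _ = ⊥-elim (b≢1 refl)
effective-alternates {col₂} {col₂} _ _ a≢b _ = ⊥-elim (a≢b refl)
effective-alternates {col₃} {col₃} _ _ a≢b _ = ⊥-elim (a≢b refl)
effective-alternates {col₄} {col₄} _ _ a≢b _ = ⊥-elim (a≢b refl)
effective-alternates {col₂} {col₃} _ _ _ _ = λ ()
effective-alternates {col₃} {col₂} _ _ _ _ = λ ()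
effective-alternates {col₄} {col₂} _ _ _ _ = λ ()
effective-alternates {col₄} {col₃} _ _ _ _ = λ ()
effective-alternates {col₂} {col₄} _ _ _ flanked with flanked refl
... | refl = λ ()
effective-alternates {col₃} {col₄} _ _ _ flanked with flanked refl
... | refl = λ ()

periodic-colouring-even : (f : ℕ → Fin 4) (n : ℕ) → (∀ x → f x ≢ col₁) →
  (∀ x → f x ≢ f (suc x)) → (∀ x → f (suc x) ≡ col₄ → f x ≡ f (suc (suc x))) →
  f n ≡ f 0 → f (suc n) ≡ f 1 → Even n
periodic-colouring-even f n not-1 proper flanked f-n f-1+n =
  alternating-return-even (λ x → effective (f x) (f (suc x)))
    (λ x → effective-alternates (not-1 x) (not-1 (suc x)) (proper x) (flanked x))
    n (cong₂ effective f-n f-1+n)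

data Consecutive (n x y : ℕ) : Set where
  up        : y ≡ suc x → Consecutive n x y
  down      : x ≡ suc y → Consecutive n x y
  wrap-down : x ≡ 0 → suc y ≡ n → Consecutive n x y
  wrap-up   : y ≡ 0 → suc x ≡ n → Consecutive n x y

decode : ∀ {n} (i j : Fin n) → Adj (C n) i j → Consecutive n (toℕ i) (toℕ j)
decode i j ij with to T-∨ ij
... | inj₁ e = up (≡ᵇ⇒≡ _ _ e)
... | inj₂ ij′ with to T-∨ ij′
...   | inj₁ e = down (≡ᵇ⇒≡ _ _ e)
...   | inj₂ ij″ with to T-∨ ij″
...     | inj₁ e = wrap-down (≡ᵇ⇒≡ _ _ (proj₁ (to T-∧ e))) (≡ᵇ⇒≡ _ _ (proj₂ (to T-∧ e)))
...     | inj₂ e = wrap-up (≡ᵇ⇒≡ _ _ (proj₁ (to T-∧ e))) (≡ᵇ⇒≡ _ _ (proj₂ (to T-∧ e)))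

encode : ∀ {n} (i j : Fin n) → Consecutive n (toℕ i) (toℕ j) → Adj (C n) i j
encode {n} i j = T-cycleAdj
  where
  -- The first disjuncts are given explicitly: Agda cannot infer them from the
  -- (stuck) Boolean expression cycleAdj n i j.
  x y : ℕ
  x = toℕ i
  y = toℕ j
  T-cycleAdj : Consecutive n x y → T (cycleAdj n i j)
  T-cycleAdj (up e) = from (T-∨ {y ≡ᵇ suc x}) (inj₁ (≡⇒≡ᵇ _ _ e))
  T-cycleAdj (down e) =
    from (T-∨ {y ≡ᵇ suc x}) (inj₂ (from (T-∨ {x ≡ᵇ suc y}) (inj₁ (≡⇒≡ᵇ _ _ e))))
  T-cycleAdj (wrap-down e₁ e₂) =
    from (T-∨ {y ≡ᵇ suc x}) (inj₂ (from (T-∨ {x ≡ᵇ suc y}) (inj₂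
      (from (T-∨ {(x ≡ᵇ 0) ∧ (suc y ≡ᵇ n)}) (inj₁
        (from (T-∧ {x ≡ᵇ 0}) (≡⇒≡ᵇ _ _ e₁ , ≡⇒≡ᵇ _ _ e₂)))))))
  T-cycleAdj (wrap-up e₁ e₂) =
    from (T-∨ {y ≡ᵇ suc x}) (inj₂ (from (T-∨ {x ≡ᵇ suc y}) (inj₂
      (from (T-∨ {(x ≡ᵇ 0) ∧ (suc y ≡ᵇ n)}) (inj₂
        (from (T-∧ {y ≡ᵇ 0}) (≡⇒≡ᵇ _ _ e₁ , ≡⇒≡ᵇ _ _ e₂)))))))

consecutive-sym : ∀ {n x y} → Consecutive n x y → Consecutive n y x
consecutive-sym (up e) = down e
consecutive-sym (down e) = up e
consecutive-sym (wrap-down e₁ e₂) = wrap-up e₁ e₂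
consecutive-sym (wrap-up e₁ e₂) = wrap-down e₁ e₂

consecutive-irreflexive : ∀ {n x} → 2 ≤ n → ¬ Consecutive n x x
consecutive-irreflexive _ (up e) = 1+n≢n (sym e)
consecutive-irreflexive _ (down e) = 1+n≢n (sym e)
consecutive-irreflexive (s≤s (s≤s _)) (wrap-down refl ())
consecutive-irreflexive (s≤s (s≤s _)) (wrap-up refl ())

cycle-symmetric : ∀ {n} (i j : Fin n) → Adj (C n) i j → Adj (C n) j i
cycle-symmetric i j ij = encode j i (consecutive-sym (decode i j ij))

cycle-irreflexive : ∀ {n} → 2 ≤ n → (i : Fin n) → ¬ Adj (C n) i i
cycle-irreflexive 2≤n i ii = consecutive-irreflexive 2≤n (decode i i ii)

step-parity : ∀ x → parity x ≢ parity (suc x)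
step-parity x same = p≢p⁻¹ (parity x) (trans same (parity-suc x))

interior-parity : ∀ {n x y} → Consecutive n x y → suc x ≢ n → suc y ≢ n → parity x ≢ parity y
interior-parity {x = x} (up refl) _ _ = step-parity x
interior-parity {y = y} (down refl) _ _ = λ same → step-parity y (sym same)
interior-parity (wrap-down _ last) _ not-last = ⊥-elim (not-last last)
interior-parity (wrap-up _ last) not-last _ = ⊥-elim (not-last last)

even-cycle-parity : ∀ {n x y} → Even n → Consecutive n x y → parity x ≢ parity y
even-cycle-parity {x = x} _ (up refl) = step-parity x
even-cycle-parity {y = y} _ (down refl) = λ same → step-parity y (sym same)
even-cycle-parity {y = y} even (wrap-down refl refl) same =
  step-parity y (trans (sym same) (sym (Even⇒parity≡0ℙ even)))
even-cycle-parity {x = x} even (wrap-up refl refl) same =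
  step-parity x (trans same (sym (Even⇒parity≡0ℙ even)))

parity-colour : ∀ {j} → Parity → Fin (3 + j)
parity-colour 0ℙ = col₂
parity-colour 1ℙ = col₃

parity-colour-injective : ∀ {j p q} → parity-colour {j} p ≡ parity-colour q → p ≡ q
parity-colour-injective {p = 0ℙ} {0ℙ} _ = refl
parity-colour-injective {p = 1ℙ} {1ℙ} _ = refl
parity-colour-injective {p = 0ℙ} {1ℙ} ()
parity-colour-injective {p = 1ℙ} {0ℙ} ()

parity-colour-not-1 : ∀ {j} p → parity-colour {j} p ≢ col₁
parity-colour-not-1 0ℙ ()
parity-colour-not-1 1ℙ ()

parity-colour-small : ∀ {j} p → toℕ (parity-colour {j} p) ≤ 2
parity-colour-small 0ℙ = s≤s z≤n
parity-colour-small 1ℙ = s≤s (s≤s z≤n)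

module Instance (k m : ℕ) where

  N : ℕ
  N = suc (suc (suc k))

  2≤N : 2 ≤ N
  2≤N = s≤s (s≤s z≤n)

  key-injective : ∀ u v → keyS'C N u ≡ keyS'C N v → u ≡ v
  key-injective (inj₁ i) (inj₁ j) same = cong inj₁ (toℕ-injective same)
  key-injective (inj₁ i) (inj₂ j) same =
    ⊥-elim (≤⇒≯ (m≤m+n N (toℕ j)) (subst (_< N) same (toℕ<n i)))
  key-injective (inj₂ i) (inj₁ j) same =
    ⊥-elim (≤⇒≯ (m≤m+n N (toℕ i)) (subst (_< N) (sym same) (toℕ<n j)))
  key-injective (inj₂ i) (inj₂ j) same = cong inj₂ (toℕ-injective (+-cancelˡ-≡ N _ _ same))

  open SplitSubdivision (C N) (cycle-irreflexive 2≤N) cycle-symmetric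
    (keyS'C N) key-injective m

  -- Position x of the cycle, counted modulo N, so that pos (suc x) follows pos x.
  pos : ℕ → Fin N
  pos x = x mod N

  toℕ-pos : ∀ x → toℕ (pos x) ≡ x % N
  toℕ-pos x = toℕ-fromℕ< (m%n<n x N)

  suc-mod : ∀ x → suc x % N ≡ suc (x % N) % N
  suc-mod x = trans (%-distribˡ-+ 1 x N) (cong (λ r → (r + x % N) % N) (m<n⇒m%n≡m 2≤N))

  Step : ℕ → ℕ → Set
  Step r r′ = r′ ≡ suc r ⊎ (r′ ≡ 0 × suc r ≡ N)

  pos-step : ∀ x → Step (toℕ (pos x)) (toℕ (pos (suc x)))
  pos-step x rewrite toℕ-pos x | toℕ-pos (suc x) | suc-mod x with suc (x % N) ≟ N
  ... | yes last = inj₂ (trans (cong (_% N) last) (n%n≡0 N) , last)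
  ... | no not-last = inj₁ (m<n⇒m%n≡m (≤∧≢⇒< (m%n<n x N) not-last))

  pos-adjacent : ∀ x → Adj (C N) (pos x) (pos (suc x))
  pos-adjacent x = encode _ _ ([ up , (λ (first , last) → wrap-up first last) ]′ (pos-step x))

  pos-adjacent⁻ : ∀ x → Adj (C N) (pos (suc x)) (pos x)
  pos-adjacent⁻ x = cycle-symmetric (pos x) (pos (suc x)) (pos-adjacent x)

  -- Two steps never return, as N ≥ 3.
  two-steps-move : ∀ {r₀ r₁ r₂} → Step r₀ r₁ → Step r₁ r₂ → r₀ ≢ r₂
  two-steps-move {r₀} (inj₁ refl) (inj₁ refl) = m≢1+n+m r₀ {1}
  two-steps-move (inj₁ refl) (inj₂ (refl , ())) refl
  two-steps-move (inj₂ (refl , ())) (inj₁ refl) refl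
  two-steps-move (inj₂ (refl , _)) (inj₂ (_ , ()))

  pos-skip-distinct : ∀ x → pos x ≢ pos (suc (suc x))
  pos-skip-distinct x same = two-steps-move (pos-step x) (pos-step (suc x)) (cong toℕ same)

  pos-period : ∀ x → pos (x + N) ≡ pos x
  pos-period x =
    toℕ-injective (trans (toℕ-pos (x + N)) (trans ([m+n]%n≡m%n x N) (sym (toℕ-pos x))))

  even-colouring : Even N → PackingColoring G 3
  even-colouring even = lift-colouring [ f , f ]′ not-1 (split-proper f f edge-ok) unique
    where
    f : Fin N → Fin 3
    f i = parity-colour (parity (toℕ i))
    differ : ∀ a b → Adj (C N) a b → f a ≢ f b
    differ a b ab same = even-cycle-parity even (decode a b ab) (parity-colour-injective same)
    edge-ok : ∀ a b → Adj (C N) a b → f a ≢ f b × f a ≢ f b × f a ≢ f b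
    edge-ok a b ab = differ a b ab , differ a b ab , differ a b ab
    not-1 : ∀ u → [ f , f ]′ u ≢ col₁
    not-1 (inj₁ a) = parity-colour-not-1 _
    not-1 (inj₂ a) = parity-colour-not-1 _
    small : ∀ u → toℕ ([ f , f ]′ u) ≤ 2
    small (inj₁ a) = parity-colour-small _
    small (inj₂ a) = parity-colour-small _
    unique : ∀ u v → 3 ≤ toℕ ([ f , f ]′ u) → [ f , f ]′ u ≡ [ f , f ]′ v → u ≡ v
    unique u _ big _ = ⊥-elim (≤⇒≯ (small u) big)

  last-or : Fin 5 → Fin N → Fin 5
  last-or s i with suc (toℕ i) ≟ N
  ... | yes _ = s
  ... | no _ = parity-colour (parity (toℕ i))

  only-one-last : ∀ {a b : Fin N} → suc (toℕ a) ≡ N → suc (toℕ b) ≡ N → a ≡ b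
  only-one-last last-a last-b = toℕ-injective (suc-injective (trans last-a (sym last-b)))

  last-or-not-1 : ∀ {s} i → s ≢ col₁ → last-or s i ≢ col₁
  last-or-not-1 i s≢1 with suc (toℕ i) ≟ N
  ... | yes _ = s≢1
  ... | no _ = parity-colour-not-1 _

  last-or-big : ∀ {s} i → 3 ≤ toℕ (last-or s i) → suc (toℕ i) ≡ N × last-or s i ≡ s
  last-or-big i big with suc (toℕ i) ≟ N
  ... | yes last = last , refl
  ... | no _ = ⊥-elim (≤⇒≯ (parity-colour-small _) big)

  last-or-unique : ∀ {s s′} a b → 3 ≤ toℕ (last-or s a) → last-or s a ≡ last-or s′ b →
                   a ≡ b × s ≡ s′
  last-or-unique a b big same with last-or-big a big
  ... | last-a , a↦s with last-or-big b (subst (λ c → 3 ≤ toℕ c) same big)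
  ...   | last-b , b↦s′ =
    only-one-last last-a last-b , trans (sym a↦s) (trans same b↦s′)

  -- Adjacent positions get different colours when the special colours are ≥ 4: an edge
  -- avoiding the last position joins positions of different parity.
  last-or-differ : ∀ s s′ a b → 3 ≤ toℕ s → 3 ≤ toℕ s′ → Adj (C N) a b →
                   last-or s a ≢ last-or s′ b
  last-or-differ s s′ a b big big′ ab with suc (toℕ a) ≟ N | suc (toℕ b) ≟ N
  ... | yes last-a | yes last-b = λ _ →
    cycle-irreflexive 2≤N a (subst (Adj (C N) a) (sym (only-one-last last-a last-b)) ab)
  ... | yes _ | no _ = λ same → ≤⇒≯ (parity-colour-small _) (subst (λ c → 3 ≤ toℕ c) same big)
  ... | no _ | yes _ = λ same →
    ≤⇒≯ (parity-colour-small _) (subst (λ c → 3 ≤ toℕ c) (sym same) big′)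
  ... | no not-last-a | no not-last-b = λ same →
    interior-parity (decode a b ab) not-last-a not-last-b (parity-colour-injective same)

  odd-colouring : PackingColoring G 5
  odd-colouring = lift-colouring [ f , f′ ]′ not-1 (split-proper f f′ edge-ok) unique
    where
    f f′ : Fin N → Fin 5
    f = last-or col₄
    f′ = last-or (fsuc col₄)
    edge-ok : ∀ a b → Adj (C N) a b → f a ≢ f b × f a ≢ f′ b × f′ a ≢ f b
    edge-ok a b ab = last-or-differ col₄ col₄ a b ≤-refl ≤-refl ab ,
                     last-or-differ col₄ (fsuc col₄) a b ≤-refl (n≤1+n 3) ab ,
                     last-or-differ (fsuc col₄) col₄ a b (n≤1+n 3) ≤-refl ab
    not-1 : ∀ u → [ f , f′ ]′ u ≢ col₁
    not-1 (inj₁ a) = last-or-not-1 a (λ ())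
    not-1 (inj₂ a) = last-or-not-1 a (λ ())
    unique : ∀ u v → 3 ≤ toℕ ([ f , f′ ]′ u) → [ f , f′ ]′ u ≡ [ f , f′ ]′ v → u ≡ v
    unique (inj₁ a) (inj₁ b) big same = cong inj₁ (proj₁ (last-or-unique a b big same))
    unique (inj₂ a) (inj₂ b) big same = cong inj₂ (proj₁ (last-or-unique a b big same))
    unique (inj₁ a) (inj₂ b) big same with () ← proj₂ (last-or-unique a b big same)
    unique (inj₂ a) (inj₁ b) big same with () ← proj₂ (last-or-unique a b big same)

  no-packing-2 : ¬ PackingColoring G 2
  no-packing-2 = no-packing-2-colouring {inj₁ (pos 0)} {inj₁ (pos 1)} {inj₁ (pos 2)}
    (pos-adjacent 0) (pos-adjacent 1) (λ same → pos-skip-distinct 0 (inj₁-injective same))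

  no-packing-4 : ¬ Even N → ¬ PackingColoring G 4
  no-packing-4 odd pc =
    odd (periodic-colouring-even (λ x → h (suc x)) N not-1 proper flanked
          (cong (λ i → colour (w i)) (pos-period 1)) (cong (λ i → colour (w i)) (pos-period 2)))
    where
    open Packing pc
    h : ℕ → Fin 4
    h x = colour (w (pos x))
    not-1 : ∀ x → h (suc x) ≢ col₁
    not-1 x = split-vertex-not-1 pc (pos-adjacent x) (pos-adjacent⁻ (suc x)) (pos-skip-distinct x)
    proper : ∀ x → h (suc x) ≢ h (suc (suc x))
    proper x = adjacent-originals-differ pc (pos-adjacent (suc x)) (not-1 x)
    flanked : ∀ x → h (suc (suc x)) ≡ col₄ → h (suc x) ≡ h (suc (suc (suc x)))
    flanked x b↦4 with h (suc x) in a↦ | h (suc (suc (suc x))) in d↦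
    ... | col₁ | _ = ⊥-elim (not-1 x a↦)
    ... | _ | col₁ = ⊥-elim (not-1 (suc (suc x)) d↦)
    ... | col₄ | _ = ⊥-elim (proper x (trans a↦ (sym b↦4)))
    ... | _ | col₄ = ⊥-elim (proper (suc x) (trans b↦4 (sym d↦)))
    ... | col₂ | col₂ = refl
    ... | col₃ | col₃ = refl
    ... | col₂ | col₃ =
      ⊥-elim (no-2-4-3 pc (pos-adjacent (suc x)) (pos-adjacent (suc (suc x))) a↦ b↦4 d↦)
    ... | col₃ | col₂ =
      ⊥-elim (no-2-4-3 pc (pos-adjacent⁻ (suc (suc x))) (pos-adjacent⁻ (suc x)) d↦ b↦4 a↦)

proposition8 : (n m : ℕ) → 3 ≤ n → 1 ≤ m →
    (Even n → PackingChromaticNumber (FSSD m (S' (C n)) (keyS'C n)) 3)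
    × (¬ Even n → PackingChromaticNumber (FSSD m (S' (C n)) (keyS'C n)) 5)
proposition8 (suc (suc (suc k))) (suc m) _ _ =
  (λ even → even-colouring even , no-packing-below no-packing-2) ,
  (λ odd → odd-colouring , no-packing-below (no-packing-4 odd))
  where open Instance k m
proposition8 (suc (suc (suc k))) zero _ ()
proposition8 (suc (suc zero)) _ (s≤s (s≤s ())) _
proposition8 (suc zero) _ (s≤s ()) _
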